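{- Let $(\ddot{\mathbb A},\ddot{\mathbb B},+,;,{}^*,\neg,1,0)$ be a BiKAT over the KAT $(\mathbb A,\mathbb B,+,;,{}^*,\neg,1,0)$. Then for all tests $e,e'\in\mathbb B$ and all actions $c,c'\in\mathbb A$, \[ \langle (e;c)^* \mid (e';c')^*\rangle;\langle \neg e\mid\neg e'\rangle \;=\; \langle e;c\mid e';c'\rangle^*;\big(\langle e;c\mid \neg e'\rangle^* + \langle \neg e\mid e';c'\rangle^*\big);\langle \neg e\mid \neg e'\rangle . \]
   Context: A Kleene algebra with tests (KAT) $(\mathbb A,\mathbb B,+,;,{}^*,\neg,1,0)$ is a Kleene algebra $(\mathbb A,+,;,{}^*,1,0)$ together with a subset $\mathbb B\subseteq\mathbb A$ of tests, closed under $+,;,\neg$ and forming a Boolean algebra under these (with $\neg$ the complement of tests); $a\le b$ means $a+b=b$. A KAT homomorphism $h$ maps tests to tests and preserves $0,1,+,;,{}^*$ and negation of tests. A BiKAT over a KAT $\mathbb A$ (the underlying KAT) is a KAT $(\ddot{\mathbb A},\ddot{\mathbb B},+,;,{}^*,\neg,1,0)$ together with two KAT homomorphisms $\langle\cdot\,]:\mathbb A\to\ddot{\mathbb A}$ and $[\,\cdot\rangle:\mathbb A\to\ddot{\mathbb A}$ (left and right embeddings) satisfying left-right commutativity: $\langle x];[y\rangle=[y\rangle;\langle x]$ for all $x,y\in\mathbb A$. The two-argument embedding is $\langle a\mid b\rangle := \langle a];[b\rangle$. -}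

module Defs where

open import Level using (Level; suc; _⊔_)
open import Relation.Binary.PropositionalEquality using (_≡_)

record KleeneAlgebra (a : Level) : Set (suc a) where
  infixl 6 _+_
  infixl 7 _︔_
  infix  4 _≤_
  infix  8 _⋆
  field
    Carrier : Set a
    _+_ _︔_ : Carrier → Carrier → Carrier
    _⋆      : Carrier → Carrier
    𝟙 𝟘     : Carrier

  _≤_ : Carrier → Carrier → Set a
  x ≤ y = x + y ≡ y

  field
    +-assoc  : ∀ x y z → (x + y) + z ≡ x + (y + z)
    +-comm   : ∀ x y → x + y ≡ y + x
    +-idem   : ∀ x → x + x ≡ x
    +-zero   : ∀ x → x + 𝟘 ≡ x
    ︔-assoc  : ∀ x y z → (x ︔ y) ︔ z ≡ x ︔ (y ︔ z)
    ︔-identityˡ : ∀ x → 𝟙 ︔ x ≡ x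
    ︔-identityʳ : ∀ x → x ︔ 𝟙 ≡ x
    ︔-zeroˡ  : ∀ x → 𝟘 ︔ x ≡ 𝟘
    ︔-zeroʳ  : ∀ x → x ︔ 𝟘 ≡ 𝟘
    distribˡ : ∀ x y z → x ︔ (y + z) ≡ (x ︔ y) + (x ︔ z)
    distribʳ : ∀ x y z → (y + z) ︔ x ≡ (y ︔ x) + (z ︔ x)
    ⋆-unfoldˡ : ∀ x → 𝟙 + x ︔ (x ⋆) ≤ x ⋆
    ⋆-unfoldʳ : ∀ x → 𝟙 + (x ⋆) ︔ x ≤ x ⋆
    ⋆-inductˡ : ∀ x y z → z + x ︔ y ≤ y → (x ⋆) ︔ z ≤ y
    ⋆-inductʳ : ∀ x y z → z + y ︔ x ≤ y → z ︔ (x ⋆) ≤ y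

record KAT (a : Level) : Set (suc a) where
  field
    KA : KleeneAlgebra a
  open KleeneAlgebra KA public
  field
    Test     : Carrier → Set a
    neg      : (e : Carrier) → Test e → Carrier
    test-𝟘   : Test 𝟘
    test-𝟙   : Test 𝟙
    test-+   : ∀ {e f} → Test e → Test f → Test (e + f)
    test-︔   : ∀ {e f} → Test e → Test f → Test (e ︔ f)
    test-¬   : ∀ {e} (p : Test e) → Test (neg e p)
    -- Boolean algebra laws (the remaining ones follow from the semiring laws)
    ︔-comm-test  : ∀ {e f} → Test e → Test f → e ︔ f ≡ f ︔ e
    ︔-idem-test  : ∀ {e} → Test e → e ︔ e ≡ e
    +-absorb-test : ∀ {e} → Test e → e + 𝟙 ≡ 𝟙
    ¬-compl-+    : ∀ {e} (p : Test e) → e + neg e p ≡ 𝟙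
    ¬-compl-︔    : ∀ {e} (p : Test e) → e ︔ neg e p ≡ 𝟘

record KATHom {a b : Level} (A : KAT a) (B : KAT b) : Set (a ⊔ b) where
  private
    module A = KAT A
    module B = KAT B
  field
    ⟦_⟧     : A.Carrier → B.Carrier
    pres-𝟘  : ⟦ A.𝟘 ⟧ ≡ B.𝟘
    pres-𝟙  : ⟦ A.𝟙 ⟧ ≡ B.𝟙
    pres-+  : ∀ x y → ⟦ x A.+ y ⟧ ≡ ⟦ x ⟧ B.+ ⟦ y ⟧
    pres-︔  : ∀ x y → ⟦ x A.︔ y ⟧ ≡ ⟦ x ⟧ B.︔ ⟦ y ⟧
    pres-⋆  : ∀ x → ⟦ x A.⋆ ⟧ ≡ ⟦ x ⟧ B.⋆
    pres-test : ∀ {e} → A.Test e → B.Test ⟦ e ⟧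
    pres-¬  : ∀ {e} (p : A.Test e) → ⟦ A.neg e p ⟧ ≡ B.neg ⟦ e ⟧ (pres-test p)

record BiKAT {a b : Level} (A : KAT a) : Set (suc (a ⊔ b)) where
  field
    AA    : KAT b
    left  : KATHom A AA
    right : KATHom A AA
  private
    module AA = KAT AA
  ⟨_] : KAT.Carrier A → AA.Carrier
  ⟨ x ] = KATHom.⟦_⟧ left x
  [_⟩ : KAT.Carrier A → AA.Carrier
  [ y ⟩ = KATHom.⟦_⟧ right y
  field
    left-right-comm : ∀ x y → ⟨ x ] AA.︔ [ y ⟩ ≡ [ y ⟩ AA.︔ ⟨ x ]

  ⟨_∣_⟩ : KAT.Carrier A → KAT.Carrier A → AA.Carrier
  ⟨ x ∣ y ⟩ = ⟨ x ] AA.︔ [ y ⟩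

-- Write X = ⟨ e︔c ], Y = [ e′︔c′ ⟩, P = ⟨ ¬e ], Q = [ ¬e′ ⟩; all four commute across the
-- two embeddings, and P, Q are idempotent. A guard that commutes with a loop body can be
-- pulled out of the loop, so the two one-sided loops on the right collapse to X⋆ and Y⋆ in
-- front of P︔Q. What remains is the commutative-KA identity (X︔Y)⋆ ︔ (X⋆ + Y⋆) = X⋆ ︔ Y⋆:
-- a run of X⋆ ︔ Y⋆ is a run of joint steps followed by a run of one side only.
module Submission where

open import Defs
open import Level using (Level)
open import Relation.Binary.Bundles using (Poset)
open import Relation.Binary.PropositionalEquality
  using (_≡_; refl; sym; trans; cong; cong₂; isEquivalence; module ≡-Reasoning)
import Relation.Binary.Reasoning.PartialOrder as PartialOrderReasoning

module KleeneAlgebraProperties {a : Level} (K : KleeneAlgebra a) where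
  open KleeneAlgebra K

  Commute : Carrier → Carrier → Set a
  Commute x y = x ︔ y ≡ y ︔ x

  Idempotent : Carrier → Set a
  Idempotent q = q ︔ q ≡ q

  ≤-reflexive : ∀ {x y} → x ≡ y → x ≤ y
  ≤-reflexive {x} refl = +-idem x

  ≤-trans : ∀ {x y z} → x ≤ y → y ≤ z → x ≤ z
  ≤-trans {x} {y} {z} x≤y y≤z = begin
    x + z       ≡⟨ cong (x +_) y≤z ⟨
    x + (y + z) ≡⟨ +-assoc x y z ⟨
    (x + y) + z ≡⟨ cong (_+ z) x≤y ⟩
    y + z       ≡⟨ y≤z ⟩
    z           ∎
    where open ≡-Reasoning

  ≤-antisym : ∀ {x y} → x ≤ y → y ≤ x → x ≡ y
  ≤-antisym {x} {y} x≤y y≤x = trans (sym y≤x) (trans (+-comm y x) x≤y)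

  ≤-poset : Poset a a a
  ≤-poset = record
    { isPartialOrder = record
      { isPreorder = record
        { isEquivalence = isEquivalence
        ; reflexive     = ≤-reflexive
        ; trans         = ≤-trans
        }
      ; antisym = ≤-antisym
      }
    }

  module ≤-Reasoning = PartialOrderReasoning ≤-poset

  +-lub : ∀ {x y z} → x ≤ z → y ≤ z → x + y ≤ z
  +-lub {x} {y} {z} x≤z y≤z = trans (+-assoc x y z) (trans (cong (x +_) y≤z) x≤z)

  x≤x+y : ∀ x y → x ≤ x + y
  x≤x+y x y = trans (sym (+-assoc x x y)) (cong (_+ y) (+-idem x))

  y≤x+y : ∀ x y → y ≤ x + y
  y≤x+y x y = trans (cong (y +_) (+-comm x y)) (trans (x≤x+y y x) (+-comm y x))

  +-mono-≤ : ∀ {x x′ y y′} → x ≤ x′ → y ≤ y′ → x + y ≤ x′ + y′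
  +-mono-≤ {x′ = x′} {y′ = y′} x≤x′ y≤y′ =
    +-lub (≤-trans x≤x′ (x≤x+y x′ y′)) (≤-trans y≤y′ (y≤x+y x′ y′))

  ︔-monoˡ-≤ : ∀ {x y} z → x ≤ y → x ︔ z ≤ y ︔ z
  ︔-monoˡ-≤ {x} {y} z x≤y = trans (sym (distribʳ z x y)) (cong (_︔ z) x≤y)

  ︔-monoʳ-≤ : ∀ {x y} z → x ≤ y → z ︔ x ≤ z ︔ y
  ︔-monoʳ-≤ {x} {y} z x≤y = trans (sym (distribˡ z x y)) (cong (z ︔_) x≤y)

  ︔-mono-≤ : ∀ {x x′ y y′} → x ≤ x′ → y ≤ y′ → x ︔ y ≤ x′ ︔ y′
  ︔-mono-≤ {x′ = x′} {y = y} x≤x′ y≤y′ = ≤-trans (︔-monoˡ-≤ y x≤x′) (︔-monoʳ-≤ x′ y≤y′)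

  𝟙≤x⋆ : ∀ x → 𝟙 ≤ x ⋆
  𝟙≤x⋆ x = ≤-trans (x≤x+y 𝟙 (x ︔ x ⋆)) (⋆-unfoldˡ x)

  x︔x⋆≤x⋆ : ∀ x → x ︔ x ⋆ ≤ x ⋆
  x︔x⋆≤x⋆ x = ≤-trans (y≤x+y 𝟙 (x ︔ x ⋆)) (⋆-unfoldˡ x)

  x⋆︔x≤x⋆ : ∀ x → x ⋆ ︔ x ≤ x ⋆
  x⋆︔x≤x⋆ x = ≤-trans (y≤x+y 𝟙 (x ⋆ ︔ x)) (⋆-unfoldʳ x)

  y≤x⋆︔y : ∀ x y → y ≤ x ⋆ ︔ y
  y≤x⋆︔y x y = ≤-trans (≤-reflexive (sym (︔-identityˡ y))) (︔-monoˡ-≤ y (𝟙≤x⋆ x))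

  y≤y︔x⋆ : ∀ x y → y ≤ y ︔ x ⋆
  y≤y︔x⋆ x y = ≤-trans (≤-reflexive (sym (︔-identityʳ y))) (︔-monoʳ-≤ y (𝟙≤x⋆ x))

  x≤x⋆ : ∀ x → x ≤ x ⋆
  x≤x⋆ x = ≤-trans (y≤y︔x⋆ x x) (x︔x⋆≤x⋆ x)

  ⋆-inductˡ′ : ∀ {x y z} → z ≤ y → x ︔ y ≤ y → x ⋆ ︔ z ≤ y
  ⋆-inductˡ′ {x} {y} {z} z≤y xy≤y = ⋆-inductˡ x y z (+-lub z≤y xy≤y)

  ⋆-inductʳ′ : ∀ {x y z} → z ≤ y → y ︔ x ≤ y → z ︔ x ⋆ ≤ y
  ⋆-inductʳ′ {x} {y} {z} z≤y yx≤y = ⋆-inductʳ x y z (+-lub z≤y yx≤y)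

  x⋆≤𝟙+x︔x⋆ : ∀ x → x ⋆ ≤ 𝟙 + x ︔ x ⋆
  x⋆≤𝟙+x︔x⋆ x = begin
    x ⋆                    ≡⟨ ︔-identityʳ (x ⋆) ⟨
    x ⋆ ︔ 𝟙                ≤⟨ ⋆-inductˡ′ (x≤x+y 𝟙 (x ︔ x ⋆)) step ⟩
    𝟙 + x ︔ x ⋆            ∎
    where
    open ≤-Reasoning
    step : x ︔ (𝟙 + x ︔ x ⋆) ≤ 𝟙 + x ︔ x ⋆
    step = ≤-trans (︔-monoʳ-≤ x (+-lub (𝟙≤x⋆ x) (x︔x⋆≤x⋆ x))) (y≤x+y 𝟙 (x ︔ x ⋆))

  ︔-slide : ∀ x y z → Commute x y → x ︔ (y ︔ z) ≡ y ︔ (x ︔ z)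
  ︔-slide x y z xy = begin
    x ︔ (y ︔ z) ≡⟨ ︔-assoc x y z ⟨
    (x ︔ y) ︔ z ≡⟨ cong (_︔ z) xy ⟩
    (y ︔ x) ︔ z ≡⟨ ︔-assoc y x z ⟩
    y ︔ (x ︔ z) ∎
    where open ≡-Reasoning

  ⋆-commute : ∀ {x q} → Commute x q → Commute (x ⋆) q
  ⋆-commute {x} {q} xq = ≤-antisym
    (⋆-inductˡ′ (y≤y︔x⋆ x q) (begin
      x ︔ (q ︔ x ⋆) ≡⟨ ︔-slide x q (x ⋆) xq ⟩
      q ︔ (x ︔ x ⋆) ≤⟨ ︔-monoʳ-≤ q (x︔x⋆≤x⋆ x) ⟩
      q ︔ x ⋆       ∎))
    (⋆-inductʳ′ (y≤x⋆︔y x q) (begin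
      (x ⋆ ︔ q) ︔ x ≡⟨ ︔-assoc (x ⋆) q x ⟩
      x ⋆ ︔ (q ︔ x) ≡⟨ cong (x ⋆ ︔_) xq ⟨
      x ⋆ ︔ (x ︔ q) ≡⟨ ︔-assoc (x ⋆) x q ⟨
      (x ⋆ ︔ x) ︔ q ≤⟨ ︔-monoˡ-≤ q (x⋆︔x≤x⋆ x) ⟩
      x ⋆ ︔ q       ∎))
    where open ≤-Reasoning

  [x︔q]⋆︔q≡x⋆︔q : ∀ {x q} → Commute x q → Idempotent q → (x ︔ q) ⋆ ︔ q ≡ x ⋆ ︔ q
  [x︔q]⋆︔q≡x⋆︔q {x} {q} xq qq = ≤-antisym
    (⋆-inductˡ′ (y≤x⋆︔y x q) (begin
      (x ︔ q) ︔ (x ⋆ ︔ q) ≡⟨ ︔-assoc x q (x ⋆ ︔ q) ⟩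
      x ︔ (q ︔ (x ⋆ ︔ q)) ≡⟨ cong (x ︔_) (︔-slide q (x ⋆) q (sym (⋆-commute xq))) ⟩
      x ︔ (x ⋆ ︔ (q ︔ q)) ≡⟨ cong (λ t → x ︔ (x ⋆ ︔ t)) qq ⟩
      x ︔ (x ⋆ ︔ q)       ≡⟨ ︔-assoc x (x ⋆) q ⟨
      (x ︔ x ⋆) ︔ q       ≤⟨ ︔-monoˡ-≤ q (x︔x⋆≤x⋆ x) ⟩
      x ⋆ ︔ q             ∎))
    (⋆-inductˡ′ (y≤x⋆︔y w q) (begin
      x ︔ (w ⋆ ︔ q)       ≡⟨ cong (λ t → x ︔ (w ⋆ ︔ t)) qq ⟨
      x ︔ (w ⋆ ︔ (q ︔ q)) ≡⟨ cong (x ︔_) (︔-slide (w ⋆) q q (⋆-commute wq)) ⟩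
      x ︔ (q ︔ (w ⋆ ︔ q)) ≡⟨ ︔-assoc x q (w ⋆ ︔ q) ⟨
      w ︔ (w ⋆ ︔ q)       ≡⟨ ︔-assoc w (w ⋆) q ⟨
      (w ︔ w ⋆) ︔ q       ≤⟨ ︔-monoˡ-≤ q (x︔x⋆≤x⋆ w) ⟩
      w ⋆ ︔ q             ∎))
    where
    open ≤-Reasoning
    w : Carrier
    w = x ︔ q
    wq : Commute w q
    wq = begin-equality
      (x ︔ q) ︔ q ≡⟨ cong (_︔ q) xq ⟩
      (q ︔ x) ︔ q ≡⟨ ︔-assoc q x q ⟩
      q ︔ (x ︔ q) ∎

  [x︔q]⋆︔[q︔s]≡x⋆︔[q︔s] : ∀ {x q} s → Commute x q → Idempotent q →
                            (x ︔ q) ⋆ ︔ (q ︔ s) ≡ x ⋆ ︔ (q ︔ s)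
  [x︔q]⋆︔[q︔s]≡x⋆︔[q︔s] {x} {q} s xq qq = begin
    (x ︔ q) ⋆ ︔ (q ︔ s) ≡⟨ ︔-assoc ((x ︔ q) ⋆) q s ⟨
    ((x ︔ q) ⋆ ︔ q) ︔ s ≡⟨ cong (_︔ s) ([x︔q]⋆︔q≡x⋆︔q xq qq) ⟩
    (x ⋆ ︔ q) ︔ s       ≡⟨ ︔-assoc (x ⋆) q s ⟩
    x ⋆ ︔ (q ︔ s)       ∎
    where open ≡-Reasoning

  [x︔y]⋆︔[x⋆+y⋆]≡x⋆︔y⋆ : ∀ {x y} → Commute x y → (x ︔ y) ⋆ ︔ (x ⋆ + y ⋆) ≡ x ⋆ ︔ y ⋆
  [x︔y]⋆︔[x⋆+y⋆]≡x⋆︔y⋆ {x} {y} xy =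
    trans (distribˡ (m ⋆) (x ⋆) (y ⋆)) (≤-antisym
      (+-lub (⋆-inductˡ′ (y≤y︔x⋆ y (x ⋆)) m︔x⋆y⋆≤x⋆y⋆)
             (⋆-inductˡ′ (y≤x⋆︔y x (y ⋆)) m︔x⋆y⋆≤x⋆y⋆))
      (⋆-inductˡ′ (≤-trans (y≤x⋆︔y m (y ⋆)) (y≤x+y _ _)) (begin
        x ︔ (m ⋆ ︔ x ⋆ + m ⋆ ︔ y ⋆)         ≡⟨ distribˡ x _ _ ⟩
        x ︔ (m ⋆ ︔ x ⋆) + x ︔ (m ⋆ ︔ y ⋆)   ≡⟨ cong₂ _+_ (︔-slide x (m ⋆) (x ⋆) xm⋆)
                                                          (︔-slide x (m ⋆) (y ⋆) xm⋆) ⟩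
        m ⋆ ︔ (x ︔ x ⋆) + m ⋆ ︔ (x ︔ y ⋆)   ≤⟨ +-mono-≤ (︔-monoʳ-≤ (m ⋆) (x︔x⋆≤x⋆ x))
                                                        (︔-monoʳ-≤ (m ⋆) x︔y⋆≤x⋆+m︔y⋆) ⟩
        m ⋆ ︔ x ⋆ + m ⋆ ︔ (x ⋆ + m ︔ y ⋆)   ≡⟨ cong (m ⋆ ︔ x ⋆ +_) (distribˡ (m ⋆) _ _) ⟩
        m ⋆ ︔ x ⋆ + (m ⋆ ︔ x ⋆ + m ⋆ ︔ (m ︔ y ⋆))
                                            ≤⟨ +-lub (x≤x+y _ _) (+-mono-≤ (≤-reflexive refl) m⋆︔m︔y⋆≤m⋆︔y⋆) ⟩
        m ⋆ ︔ x ⋆ + m ⋆ ︔ y ⋆               ∎)))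
    where
    open ≤-Reasoning
    m : Carrier
    m = x ︔ y
    xm⋆ : Commute x (m ⋆)
    xm⋆ = sym (⋆-commute (trans (︔-assoc x y x) (cong (x ︔_) (sym xy))))
    m︔x⋆y⋆≤x⋆y⋆ : m ︔ (x ⋆ ︔ y ⋆) ≤ x ⋆ ︔ y ⋆
    m︔x⋆y⋆≤x⋆y⋆ = begin
      (x ︔ y) ︔ (x ⋆ ︔ y ⋆) ≡⟨ ︔-assoc x y (x ⋆ ︔ y ⋆) ⟩
      x ︔ (y ︔ (x ⋆ ︔ y ⋆)) ≡⟨ cong (x ︔_) (︔-slide y (x ⋆) (y ⋆) (sym (⋆-commute xy))) ⟩
      x ︔ (x ⋆ ︔ (y ︔ y ⋆)) ≡⟨ ︔-assoc x (x ⋆) (y ︔ y ⋆) ⟨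
      (x ︔ x ⋆) ︔ (y ︔ y ⋆) ≤⟨ ︔-mono-≤ (x︔x⋆≤x⋆ x) (x︔x⋆≤x⋆ y) ⟩
      x ⋆ ︔ y ⋆             ∎
    x︔y⋆≤x⋆+m︔y⋆ : x ︔ y ⋆ ≤ x ⋆ + m ︔ y ⋆
    x︔y⋆≤x⋆+m︔y⋆ = begin
      x ︔ y ⋆                ≤⟨ ︔-monoʳ-≤ x (x⋆≤𝟙+x︔x⋆ y) ⟩
      x ︔ (𝟙 + y ︔ y ⋆)       ≡⟨ distribˡ x 𝟙 (y ︔ y ⋆) ⟩
      x ︔ 𝟙 + x ︔ (y ︔ y ⋆)  ≡⟨ cong₂ _+_ (︔-identityʳ x) (sym (︔-assoc x y (y ⋆))) ⟩
      x + m ︔ y ⋆            ≤⟨ +-mono-≤ (x≤x⋆ x) (≤-reflexive refl) ⟩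
      x ⋆ + m ︔ y ⋆          ∎
    m⋆︔m︔y⋆≤m⋆︔y⋆ : m ⋆ ︔ (m ︔ y ⋆) ≤ m ⋆ ︔ y ⋆
    m⋆︔m︔y⋆≤m⋆︔y⋆ = begin
      m ⋆ ︔ (m ︔ y ⋆) ≡⟨ ︔-assoc (m ⋆) m (y ⋆) ⟨
      (m ⋆ ︔ m) ︔ y ⋆ ≤⟨ ︔-monoˡ-≤ (y ⋆) (x⋆︔x≤x⋆ m) ⟩
      m ⋆ ︔ y ⋆       ∎

  ⋆-interleave-guarded : ∀ {x y p q} → Commute x y → Commute x q → Commute p y → Commute p q →
                         Idempotent p → Idempotent q →
                         (x ︔ y) ⋆ ︔ ((x ︔ q) ⋆ + (p ︔ y) ⋆) ︔ (p ︔ q) ≡ x ⋆ ︔ y ⋆ ︔ (p ︔ q)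
  ⋆-interleave-guarded {x} {y} {p} {q} xy xq py pq pp qq = begin
    (x ︔ y) ⋆ ︔ ((x ︔ q) ⋆ + (p ︔ y) ⋆) ︔ (p ︔ q)
      ≡⟨ ︔-assoc _ _ _ ⟩
    (x ︔ y) ⋆ ︔ (((x ︔ q) ⋆ + (p ︔ y) ⋆) ︔ (p ︔ q))
      ≡⟨ cong ((x ︔ y) ⋆ ︔_) (distribʳ (p ︔ q) _ _) ⟩
    (x ︔ y) ⋆ ︔ ((x ︔ q) ⋆ ︔ (p ︔ q) + (p ︔ y) ⋆ ︔ (p ︔ q))
      ≡⟨ cong ((x ︔ y) ⋆ ︔_) (cong₂ _+_ x-absorbed y-absorbed) ⟩
    (x ︔ y) ⋆ ︔ (x ⋆ ︔ (p ︔ q) + y ⋆ ︔ (p ︔ q))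
      ≡⟨ cong ((x ︔ y) ⋆ ︔_) (distribʳ (p ︔ q) _ _) ⟨
    (x ︔ y) ⋆ ︔ ((x ⋆ + y ⋆) ︔ (p ︔ q))
      ≡⟨ ︔-assoc _ _ _ ⟨
    (x ︔ y) ⋆ ︔ (x ⋆ + y ⋆) ︔ (p ︔ q)
      ≡⟨ cong (_︔ (p ︔ q)) ([x︔y]⋆︔[x⋆+y⋆]≡x⋆︔y⋆ xy) ⟩
    x ⋆ ︔ y ⋆ ︔ (p ︔ q) ∎
    where
    open ≡-Reasoning
    x-absorbed : (x ︔ q) ⋆ ︔ (p ︔ q) ≡ x ⋆ ︔ (p ︔ q)
    x-absorbed rewrite pq = [x︔q]⋆︔[q︔s]≡x⋆︔[q︔s] p xq qq
    y-absorbed : (p ︔ y) ⋆ ︔ (p ︔ q) ≡ y ⋆ ︔ (p ︔ q)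
    y-absorbed rewrite py = [x︔q]⋆︔[q︔s]≡x⋆︔[q︔s] q (sym py) pp

mainTheorem1 : {a b : Level} (A : KAT a) (Bi : BiKAT {a} {b} A) →
  let open KAT A
      module AA = KAT (BiKAT.AA Bi)
      open BiKAT Bi using (⟨_∣_⟩)
  in ∀ {e e′} (p : Test e) (p′ : Test e′) (c c′ : Carrier) →
     ⟨ (e ︔ c) ⋆ ∣ (e′ ︔ c′) ⋆ ⟩ AA.︔ ⟨ neg e p ∣ neg e′ p′ ⟩
       ≡ (⟨ e ︔ c ∣ e′ ︔ c′ ⟩ AA.⋆) AA.︔
           ((⟨ e ︔ c ∣ neg e′ p′ ⟩ AA.⋆) AA.+ (⟨ neg e p ∣ e′ ︔ c′ ⟩ AA.⋆))
           AA.︔ ⟨ neg e p ∣ neg e′ p′ ⟩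
mainTheorem1 A Bi {e} {e′} p p′ c c′ = begin
  ⟨ (e ︔ c) ⋆ ] AA.︔ [ (e′ ︔ c′) ⋆ ⟩ AA.︔ guards
    ≡⟨ cong₂ (λ s t → s AA.︔ t AA.︔ guards) (L.pres-⋆ (e ︔ c)) (R.pres-⋆ (e′ ︔ c′)) ⟩
  ⟨ e ︔ c ] AA.⋆ AA.︔ [ e′ ︔ c′ ⟩ AA.⋆ AA.︔ guards
    ≡⟨ ⋆-interleave-guarded lr lr lr lr (negated-test-idempotent left p)
                                        (negated-test-idempotent right p′) ⟨
  ⟨ e ︔ c ∣ e′ ︔ c′ ⟩ AA.⋆ AA.︔ (⟨ e ︔ c ∣ neg e′ p′ ⟩ AA.⋆ AA.+ ⟨ neg e p ∣ e′ ︔ c′ ⟩ AA.⋆) AA.︔ guards ∎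
  where
  open KAT A
  open BiKAT Bi
  module AA = KAT AA
  module L = KATHom left
  module R = KATHom right
  open KleeneAlgebraProperties AA.KA
  open ≡-Reasoning

  guards : AA.Carrier
  guards = ⟨ neg e p ∣ neg e′ p′ ⟩

  lr : ∀ {x y} → Commute ⟨ x ] [ y ⟩
  lr = left-right-comm _ _

  negated-test-idempotent : (h : KATHom A AA) → ∀ {g} (t : Test g) →
                            Idempotent (KATHom.⟦_⟧ h (neg g t))
  negated-test-idempotent h t = AA.︔-idem-test (KATHom.pres-test h (test-¬ t))
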